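{- Let $f,g:\mathbb{C}\times\mathbb{C}\to\mathbb{C}$ satisfy $g(x,y)=-g(y,x)$ and $g(a,b)f(x,c)+g(b,c)f(x,a)+g(c,a)f(x,b)=0$ for all $a,b,c,x\in\mathbb{C}$. Let $\{x_n\}_{n\ge0}$, $\{b_n\}_{n\ge0}$ be sequences of complex numbers with the $b_n$ pairwise distinct, such that $f(x_i,b_k)\ne0$ for all $i,k\ge0$ and $g(b_i,b_k)\neq0$ for $i\ne k$. Suppose a function $F$ admits an expansion \[ F(x)=\sum_{n=0}^\infty G_n f(x_n,b_n)\frac{\prod_{k=0}^{n-1}g(b_k,x)}{\prod_{k=1}^{n}f(x_k,x)} \] valid for every $x$ in a set containing all $b_n$. Then for all $n\ge0$, \[ G_n=\sum_{k=0}^{n}F(b_k)\frac{\prod_{i=1}^{n-1} f(x_i,b_k)}{\prod_{i=0,i\neq k}^{n}g(b_i,b_k)}, \] where for $n=0$ the product $\prod_{i=1}^{ -1}f(x_i,b_k)$ is interpreted as $1/f(x_0,b_k)$.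
   Context: Empty products equal $1$; the product $\prod_{i=1}^{ -1}$ follows the convention $\prod_{i=m}^{m-2}u_i=1/u_{m-1}$. -}

module Defs where

open import Data.Nat using (ℕ; zero; suc)
open import Relation.Binary.PropositionalEquality using (_≡_; _≢_)
open import Relation.Nullary using (yes; no)
open import Algebra.Structures using (IsCommutativeRing)

-- natCast one plus n = 1 + 1 + ... + 1  (n+1 summands)
natCast : {A : Set} → A → (A → A → A) → ℕ → A
natCast one plus zero = one
natCast one plus (suc n) = plus one (natCast one plus n)

-- A field of characteristic zero (the paper's ℂ is an instance), with
-- propositional equality. The inverse is total; it is only specified on
-- nonzero elements (x ⁻¹ = 1/x for x ≢ 0).
record CharZeroField : Set₁ where
  infixl 6 _+_
  infixl 7 _*_
  field
    Carrier : Set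
    _+_ _*_ : Carrier → Carrier → Carrier
    -_ : Carrier → Carrier
    0# 1# : Carrier
    _⁻¹ : Carrier → Carrier
    isCommutativeRing : IsCommutativeRing _≡_ _+_ _*_ -_ 0# 1#
    inverse : ∀ x → x ≢ 0# → x * (x ⁻¹) ≡ 1#
    charZero : ∀ n → natCast 1# _+_ n ≢ 0#

module _ (K : CharZeroField) where
  open CharZeroField K

  sumTo : ℕ → (ℕ → Carrier) → Carrier
  sumTo zero h = 0#
  sumTo (suc n) h = sumTo n h + h n

  prodTo : ℕ → (ℕ → Carrier) → Carrier
  prodTo zero h = 1#
  prodTo (suc n) h = prodTo n h * h n

  prodToExcept : ℕ → ℕ → (ℕ → Carrier) → Carrier
  prodToExcept zero k h = 1#
  prodToExcept (suc n) k h with n Data.Nat.≟ k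
  ... | yes _ = prodToExcept n k h
  ... | no _ = prodToExcept n k h * h n

  expTerm : (f g : Carrier → Carrier → Carrier) (x b G : ℕ → Carrier)
            → ℕ → Carrier → Carrier
  expTerm f g x b G n y =
    G n * f (x n) (b n) * prodTo n (λ k → g (b k) y)
      * (prodTo n (λ k → f (x (suc k)) y)) ⁻¹

  -- ∏_{i=1}^{n-1} f(x_i, b_k), with the convention that for n = 0 it is 1/f(x_0,b_k)
  numProd : (f : Carrier → Carrier → Carrier) (x b : ℕ → Carrier) → ℕ → ℕ → Carrier
  numProd f x b zero k = (f (x 0) (b k)) ⁻¹
  numProd f x b (suc m) k = prodTo m (λ i → f (x (suc i)) (b k))

  inversionFormula : (f g : Carrier → Carrier → Carrier) (x b : ℕ → Carrier)
                     (F : Carrier → Carrier) → ℕ → Carrier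
  inversionFormula f g x b F n =
    sumTo (suc n) (λ k → F (b k) * numProd f x b n k
                         * (prodToExcept (suc n) k (λ i → g (b i) (b k))) ⁻¹)

module Submission where

-- Write T j k for the value at y = b k of the j-th basis function
--   f(x_j,b_j) ∏_{i<j} g(b_i,y) / ∏_{i<j} f(x_{i+1},y),
-- and C n k for the k-th coefficient of the claimed inversion formula for G_n.
-- Since g(b_k,b_k) = 0 (antisymmetry in characteristic ≠ 2), T j k = 0 for
-- k < j, so the expansion evaluated at b_k is the finite lower-triangular sum
-- F(b_k) = Σ_{j≤k} G_j T j k.  Inverting a triangular system only needs that
-- the rows of T are orthonormal to the rows of C:  Σ_{k≤n} T j k C n k = δ_{jn}
-- for j ≤ n (TriangularInversion).  The diagonal case is a cancellation; the
-- off-diagonal case reduces to the partial-fraction identity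
--   Σ_{k≤p+1} ∏_{l<p} f(y_l,c_k) / ∏_{i≤p+1, i≠k} g(c_i,c_k) = 0,
-- a generalised Lagrange-interpolation identity proved by induction on p from
-- the three-term relation (PartialFractions).

open import Defs
open import Data.Nat using (ℕ; suc; _≤_)
open import Data.Product using (∃)
open import Relation.Binary.PropositionalEquality using (_≡_; _≢_)

open import Data.Nat using (zero; z≤n; s≤s; _<_; _∸_; _≟_)
open import Data.Nat using () renaming (_+_ to _+ℕ_)
import Data.Nat.Properties as ℕₚ
open import Data.Product using (_,_)
open import Data.Empty using (⊥-elim)
open import Relation.Nullary using (yes; no)
open import Relation.Binary.PropositionalEquality
  using (refl; sym; trans; cong; cong₂; subst; module ≡-Reasoning)
open import Algebra.Bundles using (CommutativeRing)
import Algebra.Properties.Ring as RingProperties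
import Algebra.Properties.AbelianGroup as AbelianGroupProperties
import Algebra.Solver.CommutativeMonoid as CommutativeMonoidSolver

module FieldLemmas (K : CharZeroField) where
  open CharZeroField K public

  commutativeRing : CommutativeRing _ _
  commutativeRing = record { isCommutativeRing = isCommutativeRing }

  open CommutativeRing commutativeRing public
    using ( +-assoc; +-comm; +-identityˡ; +-identityʳ; -‿inverseˡ; -‿inverseʳ
          ; *-assoc; *-comm; *-identityˡ; *-identityʳ; zeroˡ; zeroʳ
          ; distribˡ; distribʳ; *-commutativeMonoid )
  open CommutativeRing commutativeRing using (ring; +-abelianGroup)
  open RingProperties ring public using (-‿distribʳ-*)
  open AbelianGroupProperties +-abelianGroup public
    renaming (⁻¹-∙-comm to -‿+-comm; ε⁻¹≈ε to -0#≡0#)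
    using ()

  module ×-Solver = CommutativeMonoidSolver *-commutativeMonoid
  open ×-Solver using (_⊕_; _⊜_) public

  open ≡-Reasoning

  inverseˡ : ∀ a → a ≢ 0# → a ⁻¹ * a ≡ 1#
  inverseˡ a a≢0 = trans (*-comm _ _) (inverse a a≢0)

  cancel-nonzero : ∀ a c → a ≢ 0# → a * c ≡ 0# → c ≡ 0#
  cancel-nonzero a c a≢0 ac≡0 = begin
    c                ≡⟨ sym (*-identityˡ c) ⟩
    1# * c           ≡⟨ cong (_* c) (sym (inverseˡ a a≢0)) ⟩
    a ⁻¹ * a * c     ≡⟨ *-assoc _ _ _ ⟩
    a ⁻¹ * (a * c)   ≡⟨ cong (a ⁻¹ *_) ac≡0 ⟩
    a ⁻¹ * 0#        ≡⟨ zeroʳ _ ⟩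
    0#               ∎

  *-nonzero : ∀ {a c} → a ≢ 0# → c ≢ 0# → a * c ≢ 0#
  *-nonzero a≢0 c≢0 ac≡0 = c≢0 (cancel-nonzero _ _ a≢0 ac≡0)

  inverse-unique : ∀ a c → a ≢ 0# → a * c ≡ 1# → c ≡ a ⁻¹
  inverse-unique a c a≢0 ac≡1 = begin
    c                ≡⟨ sym (*-identityˡ c) ⟩
    1# * c           ≡⟨ cong (_* c) (sym (inverseˡ a a≢0)) ⟩
    a ⁻¹ * a * c     ≡⟨ *-assoc _ _ _ ⟩
    a ⁻¹ * (a * c)   ≡⟨ cong (a ⁻¹ *_) ac≡1 ⟩
    a ⁻¹ * 1#        ≡⟨ *-identityʳ _ ⟩
    a ⁻¹             ∎

  inverse-* : ∀ a c → a ≢ 0# → c ≢ 0# → (a * c) ⁻¹ ≡ a ⁻¹ * c ⁻¹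
  inverse-* a c a≢0 c≢0 = sym (inverse-unique (a * c) (a ⁻¹ * c ⁻¹) (*-nonzero a≢0 c≢0) (begin
    a * c * (a ⁻¹ * c ⁻¹)
      ≡⟨ ×-Solver.solve 4 (λ a c a' c' → (a ⊕ c) ⊕ (a' ⊕ c') ⊜ (a ⊕ a') ⊕ (c ⊕ c'))
                         refl a c (a ⁻¹) (c ⁻¹) ⟩
    a * a ⁻¹ * (c * c ⁻¹)  ≡⟨ cong₂ _*_ (inverse a a≢0) (inverse c c≢0) ⟩
    1# * 1#                ≡⟨ *-identityˡ 1# ⟩
    1#                     ∎))

  inverse-opposite : ∀ u v → u ≢ 0# → v ≢ 0# → v + u ≡ 0# → u ⁻¹ + v ⁻¹ ≡ 0#
  inverse-opposite u v u≢0 v≢0 v+u≡0 = begin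
    u ⁻¹ + v ⁻¹
      ≡⟨ cong₂ _+_ (sym (trans (cong (u ⁻¹ *_) (inverse v v≢0)) (*-identityʳ _)))
                   (sym (trans (cong (v ⁻¹ *_) (inverse u u≢0)) (*-identityʳ _))) ⟩
    u ⁻¹ * (v * v ⁻¹) + v ⁻¹ * (u * u ⁻¹)
      ≡⟨ cong₂ _+_ (×-Solver.solve 3 (λ u' v v' → u' ⊕ (v ⊕ v') ⊜ (u' ⊕ v') ⊕ v) refl (u ⁻¹) v (v ⁻¹))
                   (×-Solver.solve 3 (λ u u' v' → v' ⊕ (u ⊕ u') ⊜ (u' ⊕ v') ⊕ u) refl u (u ⁻¹) (v ⁻¹)) ⟩
    u ⁻¹ * v ⁻¹ * v + u ⁻¹ * v ⁻¹ * u  ≡⟨ sym (distribˡ _ v u) ⟩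
    u ⁻¹ * v ⁻¹ * (v + u)              ≡⟨ cong (_ *_) v+u≡0 ⟩
    u ⁻¹ * v ⁻¹ * 0#                   ≡⟨ zeroʳ _ ⟩
    0#                                 ∎

  self-opposite⇒zero : ∀ z → z ≡ - z → z ≡ 0#
  self-opposite⇒zero z z≡-z = cancel-nonzero (1# + 1#) z (charZero 1) (begin
    (1# + 1#) * z        ≡⟨ distribʳ z 1# 1# ⟩
    1# * z + 1# * z      ≡⟨ cong₂ _+_ (*-identityˡ z) (*-identityˡ z) ⟩
    z + z                ≡⟨ cong (z +_) z≡-z ⟩
    z + - z              ≡⟨ -‿inverseʳ z ⟩
    0#                   ∎)

  cancel-factor : ∀ a h p → h ≢ 0# → p ≢ 0# → a * (h * p) ⁻¹ * h ≡ a * p ⁻¹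
  cancel-factor a h p h≢0 p≢0 = begin
    a * (h * p) ⁻¹ * h        ≡⟨ cong (λ z → a * z * h) (inverse-* h p h≢0 p≢0) ⟩
    a * (h ⁻¹ * p ⁻¹) * h
      ≡⟨ ×-Solver.solve 4 (λ a h' p' h → (a ⊕ (h' ⊕ p')) ⊕ h ⊜ (a ⊕ p') ⊕ (h' ⊕ h))
                         refl a (h ⁻¹) (p ⁻¹) h ⟩
    a * p ⁻¹ * (h ⁻¹ * h)     ≡⟨ cong (a * p ⁻¹ *_) (inverseˡ h h≢0) ⟩
    a * p ⁻¹ * 1#             ≡⟨ *-identityʳ _ ⟩
    a * p ⁻¹                  ∎

  cancel-factors : ∀ a p q r s → p ≢ 0# → q ≢ 0# → s ≢ 0# →
                   a * p * q ⁻¹ * (q * r * (p * s) ⁻¹) ≡ a * (r * s ⁻¹)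
  cancel-factors a p q r s p≢0 q≢0 s≢0 = begin
    a * p * q ⁻¹ * (q * r * (p * s) ⁻¹)
      ≡⟨ cong (λ z → a * p * q ⁻¹ * (q * r * z)) (inverse-* p s p≢0 s≢0) ⟩
    a * p * q ⁻¹ * (q * r * (p ⁻¹ * s ⁻¹))
      ≡⟨ ×-Solver.solve 7 (λ a p q r p' q' s' →
              ((a ⊕ p) ⊕ q') ⊕ ((q ⊕ r) ⊕ (p' ⊕ s')) ⊜ (a ⊕ (r ⊕ s')) ⊕ ((p ⊕ p') ⊕ (q ⊕ q')))
           refl a p q r (p ⁻¹) (q ⁻¹) (s ⁻¹) ⟩
    a * (r * s ⁻¹) * (p * p ⁻¹ * (q * q ⁻¹))
      ≡⟨ cong (λ z → a * (r * s ⁻¹) * z) (cong₂ _*_ (inverse p p≢0) (inverse q q≢0)) ⟩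
    a * (r * s ⁻¹) * (1# * 1#)  ≡⟨ cong (a * (r * s ⁻¹) *_) (*-identityˡ 1#) ⟩
    a * (r * s ⁻¹) * 1#         ≡⟨ *-identityʳ _ ⟩
    a * (r * s ⁻¹)              ∎

module FiniteSums (K : CharZeroField) where
  open FieldLemmas K
  open ≡-Reasoning

  sum-cong : ∀ n {h h′} → (∀ i → i < n → h i ≡ h′ i) → sumTo K n h ≡ sumTo K n h′
  sum-cong zero     h≡h′ = refl
  sum-cong (suc n) h≡h′ =
    cong₂ _+_ (sum-cong n (λ i i<n → h≡h′ i (ℕₚ.m<n⇒m<1+n i<n))) (h≡h′ n (ℕₚ.n<1+n n))

  sum-zero : ∀ n {h} → (∀ i → i < n → h i ≡ 0#) → sumTo K n h ≡ 0#
  sum-zero n h≡0 = trans (sum-cong n h≡0) (zero-sum n)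
    where
    zero-sum : ∀ n → sumTo K n (λ _ → 0#) ≡ 0#
    zero-sum zero    = refl
    zero-sum (suc n) = trans (cong (_+ 0#) (zero-sum n)) (+-identityʳ 0#)

  sum-tail-zero : ∀ d a {h} → (∀ i → a ≤ i → h i ≡ 0#) → sumTo K (d +ℕ a) h ≡ sumTo K a h
  sum-tail-zero zero    a h≡0 = refl
  sum-tail-zero (suc d) a h≡0 =
    trans (cong₂ _+_ (sum-tail-zero d a h≡0) (h≡0 (d +ℕ a) (ℕₚ.m≤n+m a d))) (+-identityʳ _)

  sum-head : ∀ n h → sumTo K (suc n) h ≡ h 0 + sumTo K n (λ i → h (suc i))
  sum-head zero    h = trans (+-identityˡ _) (sym (+-identityʳ _))
  sum-head (suc n) h = trans (cong (_+ h (suc n)) (sum-head n h)) (+-assoc _ _ _)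

  sum-head-zero : ∀ j d {h} → (∀ i → i < j → h i ≡ 0#) →
                  sumTo K (j +ℕ d) h ≡ sumTo K d (λ k → h (j +ℕ k))
  sum-head-zero zero    d h≡0 = refl
  sum-head-zero (suc j) d {h} h≡0 = begin
    sumTo K (suc (j +ℕ d)) h                      ≡⟨ sum-head (j +ℕ d) h ⟩
    h 0 + sumTo K (j +ℕ d) (λ i → h (suc i))
      ≡⟨ cong₂ _+_ (h≡0 0 (s≤s z≤n)) (sum-head-zero j d (λ i i<j → h≡0 (suc i) (s≤s i<j))) ⟩
    0# + sumTo K d (λ k → h (suc (j +ℕ k)))       ≡⟨ +-identityˡ _ ⟩
    sumTo K d (λ k → h (suc (j +ℕ k)))            ∎

  sum-+ : ∀ n h h′ → sumTo K n (λ i → h i + h′ i) ≡ sumTo K n h + sumTo K n h′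
  sum-+ zero    h h′ = sym (+-identityˡ 0#)
  sum-+ (suc n) h h′ = begin
    sumTo K n (λ i → h i + h′ i) + (h n + h′ n)  ≡⟨ cong (_+ (h n + h′ n)) (sum-+ n h h′) ⟩
    (H + H′) + (h n + h′ n)                      ≡⟨ +-assoc H H′ _ ⟩
    H + (H′ + (h n + h′ n))                      ≡⟨ cong (H +_) (sym (+-assoc H′ (h n) (h′ n))) ⟩
    H + ((H′ + h n) + h′ n)                      ≡⟨ cong (λ z → H + (z + h′ n)) (+-comm H′ (h n)) ⟩
    H + ((h n + H′) + h′ n)                      ≡⟨ cong (H +_) (+-assoc (h n) H′ (h′ n)) ⟩
    H + (h n + (H′ + h′ n))                      ≡⟨ sym (+-assoc H (h n) _) ⟩
    (H + h n) + (H′ + h′ n)                      ∎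
    where
    H  = sumTo K n h
    H′ = sumTo K n h′

  sum-*ˡ : ∀ n c h → sumTo K n (λ i → c * h i) ≡ c * sumTo K n h
  sum-*ˡ zero    c h = sym (zeroʳ c)
  sum-*ˡ (suc n) c h = trans (cong (_+ c * h n) (sum-*ˡ n c h)) (sym (distribˡ c _ _))

  sum-*ʳ : ∀ n c h → sumTo K n (λ i → h i * c) ≡ sumTo K n h * c
  sum-*ʳ zero    c h = sym (zeroˡ c)
  sum-*ʳ (suc n) c h = trans (cong (_+ h n * c) (sum-*ʳ n c h)) (sym (distribʳ c _ _))

  sum-neg : ∀ n h → sumTo K n (λ i → - h i) ≡ - sumTo K n h
  sum-neg zero    h = sym -0#≡0#
  sum-neg (suc n) h = trans (cong (_+ - h n) (sum-neg n h)) (-‿+-comm _ _)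

  sum-swap : ∀ n m (h : ℕ → ℕ → Carrier) →
             sumTo K n (λ i → sumTo K m (h i)) ≡ sumTo K m (λ j → sumTo K n (λ i → h i j))
  sum-swap zero    m h = sym (sum-zero m (λ _ _ → refl))
  sum-swap (suc n) m h =
    trans (cong (_+ sumTo K m (h n)) (sum-swap n m h)) (sym (sum-+ m (λ j → sumTo K n (λ i → h i j)) (h n)))

  sum-relation-zero : ∀ n u v w → (∀ i → u i + v i + w i ≡ 0#) →
                      sumTo K n v ≡ 0# → sumTo K n w ≡ 0# → sumTo K n u ≡ 0#
  sum-relation-zero n u v w relation Σv≡0 Σw≡0 = begin
    sumTo K n u                                    ≡⟨ sym (trans (cong₂ (λ s t → sumTo K n u + s + t) Σv≡0 Σw≡0)
                                                                 (trans (+-identityʳ _) (+-identityʳ _))) ⟩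
    sumTo K n u + sumTo K n v + sumTo K n w        ≡⟨ cong (_+ sumTo K n w) (sym (sum-+ n u v)) ⟩
    sumTo K n (λ i → u i + v i) + sumTo K n w      ≡⟨ sym (sum-+ n _ w) ⟩
    sumTo K n (λ i → u i + v i + w i)              ≡⟨ sum-zero n (λ i _ → relation i) ⟩
    0#                                             ∎

  prod-zero : ∀ n h i → i < n → h i ≡ 0# → prodTo K n h ≡ 0#
  prod-zero (suc n) h i i<1+n hᵢ≡0 with i ≟ n
  ... | yes refl = trans (cong (prodTo K n h *_) hᵢ≡0) (zeroʳ _)
  ... | no  i≢n  =
    trans (cong (_* h n) (prod-zero n h i (ℕₚ.≤∧≢⇒< (ℕₚ.≤-pred i<1+n) i≢n) hᵢ≡0)) (zeroˡ _)

  prod-nonzero : ∀ n h → (∀ i → i < n → h i ≢ 0#) → prodTo K n h ≢ 0#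
  prod-nonzero zero    h h≢0 = charZero 0
  prod-nonzero (suc n) h h≢0 =
    *-nonzero (prod-nonzero n h (λ i i<n → h≢0 i (ℕₚ.m<n⇒m<1+n i<n))) (h≢0 n (ℕₚ.n<1+n n))

  prod-head : ∀ n h → prodTo K (suc n) h ≡ h 0 * prodTo K n (λ i → h (suc i))
  prod-head zero    h = trans (*-identityˡ _) (sym (*-identityʳ _))
  prod-head (suc n) h = trans (cong (_* h (suc n)) (prod-head n h)) (*-assoc _ _ _)

  prod-split : ∀ a d h → prodTo K (a +ℕ d) h ≡ prodTo K a h * prodTo K d (λ k → h (a +ℕ k))
  prod-split zero    d h = sym (*-identityˡ _)
  prod-split (suc a) d h = begin
    prodTo K (suc (a +ℕ d)) h                                        ≡⟨ prod-head (a +ℕ d) h ⟩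
    h 0 * prodTo K (a +ℕ d) (λ i → h (suc i))                        ≡⟨ cong (h 0 *_) (prod-split a d (λ i → h (suc i))) ⟩
    h 0 * (prodTo K a (λ i → h (suc i)) * prodTo K d (λ k → h (suc (a +ℕ k))))
                                                                    ≡⟨ sym (*-assoc _ _ _) ⟩
    h 0 * prodTo K a (λ i → h (suc i)) * prodTo K d (λ k → h (suc (a +ℕ k)))
                                                                    ≡⟨ cong (_* prodTo K d (λ k → h (suc (a +ℕ k)))) (sym (prod-head a h)) ⟩
    prodTo K (suc a) h * prodTo K d (λ k → h (suc (a +ℕ k)))         ∎

  except-nonzero : ∀ n k h → (∀ i → i < n → i ≢ k → h i ≢ 0#) → prodToExcept K n k h ≢ 0#
  except-nonzero zero    k h h≢0 = charZero 0
  except-nonzero (suc n) k h h≢0 with n ≟ k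
  ... | yes _   = except-nonzero n k h (λ i i<n → h≢0 i (ℕₚ.m<n⇒m<1+n i<n))
  ... | no  n≢k = *-nonzero (except-nonzero n k h (λ i i<n → h≢0 i (ℕₚ.m<n⇒m<1+n i<n)))
                            (h≢0 n (ℕₚ.n<1+n n) n≢k)

  except-beyond : ∀ n k h → n ≤ k → prodToExcept K n k h ≡ prodTo K n h
  except-beyond zero    k h _ = refl
  except-beyond (suc n) k h n<k with n ≟ k
  ... | yes n≡k = ⊥-elim (ℕₚ.<⇒≢ n<k n≡k)
  ... | no  _   = cong (_* h n) (except-beyond n k h (ℕₚ.<⇒≤ n<k))

  except-last : ∀ n h → prodToExcept K (suc n) n h ≡ prodTo K n h
  except-last n h with n ≟ n
  ... | yes _   = except-beyond n n h ℕₚ.≤-refl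
  ... | no  n≢n = ⊥-elim (n≢n refl)

  except-step : ∀ n k h → k < n → prodToExcept K (suc n) k h ≡ prodToExcept K n k h * h n
  except-step n k h k<n with n ≟ k
  ... | yes n≡k = ⊥-elim (ℕₚ.<⇒≢ k<n (sym n≡k))
  ... | no  _   = refl

  except-head : ∀ n k h → prodToExcept K (suc n) (suc k) h ≡ h 0 * prodToExcept K n k (λ i → h (suc i))
  except-head zero    k h = *-comm _ _
  except-head (suc n) k h with suc n ≟ suc k | n ≟ k
  ... | yes _     | yes _   = except-head n k h
  ... | no  _     | no  _   = trans (cong (_* h (suc n)) (except-head n k h)) (*-assoc _ _ _)
  ... | yes 1+n≡1+k | no n≢k  = ⊥-elim (n≢k (ℕₚ.suc-injective 1+n≡1+k))
  ... | no  1+n≢1+k | yes n≡k = ⊥-elim (1+n≢1+k (cong suc n≡k))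

  except-split : ∀ j n k h →
                 prodToExcept K (j +ℕ n) (j +ℕ k) h ≡ prodTo K j h * prodToExcept K n k (λ i → h (j +ℕ i))
  except-split zero    n k h = sym (*-identityˡ _)
  except-split (suc j) n k h = begin
    prodToExcept K (suc (j +ℕ n)) (suc (j +ℕ k)) h
      ≡⟨ except-head (j +ℕ n) (j +ℕ k) h ⟩
    h 0 * prodToExcept K (j +ℕ n) (j +ℕ k) (λ i → h (suc i))
      ≡⟨ cong (h 0 *_) (except-split j n k (λ i → h (suc i))) ⟩
    h 0 * (prodTo K j (λ i → h (suc i)) * E)
      ≡⟨ sym (*-assoc _ _ _) ⟩
    h 0 * prodTo K j (λ i → h (suc i)) * E
      ≡⟨ cong (_* E) (sym (prod-head j h)) ⟩
    prodTo K (suc j) h * E ∎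
    where
    E = prodToExcept K n k (λ i → h (suc (j +ℕ i)))

module PartialFractions (K : CharZeroField) where
  open FieldLemmas K
  open FiniteSums K
  open ≡-Reasoning

  g-diagonal : ∀ {g : Carrier → Carrier → Carrier} → (∀ u v → g u v ≡ - g v u) → ∀ a → g a a ≡ 0#
  g-diagonal {g} antisym a = self-opposite⇒zero (g a a) (antisym a a)

  Separated : (g : Carrier → Carrier → Carrier) → (ℕ → Carrier) → Set
  Separated g c = ∀ i k → i ≢ k → g (c i) (c k) ≢ 0#

  separated-drop : ∀ g c j → Separated g c → Separated g (λ i → c (j +ℕ i))
  separated-drop g c j sep i k i≢k = sep (j +ℕ i) (j +ℕ k) (λ e → i≢k (ℕₚ.+-cancelˡ-≡ j i k e))

  module _ (f g : Carrier → Carrier → Carrier) where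

    pfCoeff : (c y : ℕ → Carrier) → (p m k : ℕ) → Carrier
    pfCoeff c y p m k =
      prodTo K p (λ l → f (y l) (c k)) * (prodToExcept K m k (λ i → g (c i) (c k))) ⁻¹

    pfSum : (c y : ℕ → Carrier) → ℕ → Carrier
    pfSum c y p = sumTo K (suc (suc p)) (pfCoeff c y p (suc (suc p)))

    pfCoeff-drop-last : ∀ c y q m k → Separated g c → k < m →
                        pfCoeff c y q (suc m) k * g (c m) (c k) ≡ pfCoeff c y q m k
    pfCoeff-drop-last c y q m k sep k<m = begin
      ψ * (prodToExcept K (suc m) k H) ⁻¹ * H m  ≡⟨ cong (λ z → ψ * z ⁻¹ * H m) (except-step m k H k<m) ⟩
      ψ * (prodToExcept K m k H * H m) ⁻¹ * H m  ≡⟨ cong (λ z → ψ * z ⁻¹ * H m) (*-comm _ (H m)) ⟩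
      ψ * (H m * prodToExcept K m k H) ⁻¹ * H m  ≡⟨ cancel-factor ψ (H m) _ (sep m k (λ e → ℕₚ.<⇒≢ k<m (sym e)))
                                                      (except-nonzero m k H (λ i _ → sep i k)) ⟩
      ψ * (prodToExcept K m k H) ⁻¹              ∎
      where
      ψ = prodTo K q (λ l → f (y l) (c k))
      H = λ i → g (c i) (c k)

    module _ (antisym : ∀ u v → g u v ≡ - g v u) where

      pfCoeff-drop-first : ∀ c y q m k → Separated g c →
                           pfCoeff c y q (suc m) (suc k) * g (c (suc k)) (c 0)
                             ≡ - pfCoeff (λ i → c (suc i)) y q m k
      pfCoeff-drop-first c y q m k sep = begin
        ψ * (prodToExcept K (suc m) (suc k) H) ⁻¹ * g (c (suc k)) (c 0)
          ≡⟨ cong₂ (λ z w → ψ * z ⁻¹ * w) (except-head m k H) (antisym _ _) ⟩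
        ψ * (H 0 * P) ⁻¹ * (- H 0)   ≡⟨ sym (-‿distribʳ-* _ _) ⟩
        - (ψ * (H 0 * P) ⁻¹ * H 0)   ≡⟨ cong -_ (cancel-factor ψ (H 0) P (sep 0 (suc k) (λ ()))
                                          (except-nonzero m k _ (λ i _ i≢k → sep (suc i) (suc k) (λ e → i≢k (ℕₚ.suc-injective e))))) ⟩
        - (ψ * P ⁻¹)                 ∎
        where
        ψ = prodTo K q (λ l → f (y l) (c (suc k)))
        H = λ i → g (c i) (c (suc k))
        P = prodToExcept K m k (λ i → H (suc i))

      weighted-last : ∀ c y q → Separated g c →
                      sumTo K (suc (suc (suc q))) (λ k → pfCoeff c y q (suc (suc (suc q))) k * g (c (suc (suc q))) (c k))
                        ≡ pfSum c y q
      weighted-last c y q sep = begin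
        sumTo K L (λ k → pf k * g (c L) (c k)) + pf L * g (c L) (c L)
          ≡⟨ cong₂ _+_ (sum-cong L (λ k k<L → pfCoeff-drop-last c y q L k sep k<L))
                       (trans (cong (pf L *_) (g-diagonal antisym (c L))) (zeroʳ _)) ⟩
        pfSum c y q + 0#  ≡⟨ +-identityʳ _ ⟩
        pfSum c y q       ∎
        where
        L  = suc (suc q)
        pf = pfCoeff c y q (suc L)

      weighted-first : ∀ c y q → Separated g c →
                       sumTo K (suc (suc (suc q))) (λ k → pfCoeff c y q (suc (suc (suc q))) k * g (c k) (c 0))
                         ≡ - pfSum (λ i → c (suc i)) y q
      weighted-first c y q sep = begin
        sumTo K (suc L) (λ k → pf k * g (c k) (c 0))
          ≡⟨ sum-head L _ ⟩
        pf 0 * g (c 0) (c 0) + sumTo K L (λ k → pf (suc k) * g (c (suc k)) (c 0))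
          ≡⟨ cong₂ _+_ (trans (cong (pf 0 *_) (g-diagonal antisym (c 0))) (zeroʳ _))
                       (sum-cong L (λ k _ → pfCoeff-drop-first c y q L k sep)) ⟩
        0# + sumTo K L (λ k → - pfCoeff (λ i → c (suc i)) y q L k)
          ≡⟨ trans (+-identityˡ _) (sum-neg L _) ⟩
        - pfSum (λ i → c (suc i)) y q ∎
        where
        L  = suc (suc q)
        pf = pfCoeff c y q (suc L)

      module _ (three-term : ∀ a b c y → g a b * f y c + g b c * f y a + g c a * f y b ≡ 0#) where

        -- Induction step: multiply by g(c_0, c_L) and expand with the three-term
        -- relation g(c_0,c_L) f(y_q,c_k) = - g(c_L,c_k) f(y_q,c_0) - g(c_k,c_0) f(y_q,c_L).
        pfSum-step : ∀ c y q → Separated g c → pfSum c y q ≡ 0# → pfSum (λ i → c (suc i)) y q ≡ 0# →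
                     pfSum c y (suc q) ≡ 0#
        pfSum-step c y q sep last≡0 first≡0 =
          cancel-nonzero (g (c 0) (c L)) _ (sep 0 L (λ ())) (begin
            g (c 0) (c L) * pfSum c y (suc q)            ≡⟨ sym (sum-*ˡ M _ _) ⟩
            sumTo K M (λ k → g (c 0) (c L) * pfCoeff c y (suc q) M k)
                                                         ≡⟨ sum-cong M (λ k _ → rearrange k) ⟩
            sumTo K M u                                  ≡⟨ sum-relation-zero M u v w relation Σv≡0 Σw≡0 ⟩
            0#                                           ∎)
          where
          L  = suc (suc q)
          M  = suc L
          φ  = f (y q)
          pf = pfCoeff c y q M
          u v w : ℕ → Carrier
          u k = pf k * (g (c 0) (c L) * φ (c k))
          v k = pf k * g (c L) (c k) * φ (c 0)
          w k = pf k * g (c k) (c 0) * φ (c L)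

          rearrange : ∀ k → g (c 0) (c L) * pfCoeff c y (suc q) M k ≡ u k
          rearrange k = ×-Solver.solve 4 (λ G ψ φₖ e → G ⊕ ((ψ ⊕ φₖ) ⊕ e) ⊜ (ψ ⊕ e) ⊕ (G ⊕ φₖ))
                          refl (g (c 0) (c L)) (prodTo K q (λ l → f (y l) (c k))) (φ (c k)) _

          relation : ∀ k → u k + v k + w k ≡ 0#
          relation k = begin
            u k + v k + w k
              ≡⟨ cong₂ (λ s t → u k + s + t) (*-assoc _ _ _) (*-assoc _ _ _) ⟩
            pf k * (g (c 0) (c L) * φ (c k)) + pf k * (g (c L) (c k) * φ (c 0)) + pf k * (g (c k) (c 0) * φ (c L))
              ≡⟨ sym (trans (distribˡ (pf k) _ _) (cong (_+ pf k * (g (c k) (c 0) * φ (c L))) (distribˡ (pf k) _ _))) ⟩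
            pf k * (g (c 0) (c L) * φ (c k) + g (c L) (c k) * φ (c 0) + g (c k) (c 0) * φ (c L))
              ≡⟨ cong (pf k *_) (three-term (c 0) (c L) (c k) (y q)) ⟩
            pf k * 0#  ≡⟨ zeroʳ _ ⟩
            0#         ∎

          Σv≡0 : sumTo K M v ≡ 0#
          Σv≡0 = begin
            sumTo K M v                                       ≡⟨ sum-*ʳ M (φ (c 0)) _ ⟩
            sumTo K M (λ k → pf k * g (c L) (c k)) * φ (c 0)  ≡⟨ cong (_* φ (c 0)) (trans (weighted-last c y q sep) last≡0) ⟩
            0# * φ (c 0)                                      ≡⟨ zeroˡ _ ⟩
            0#                                                ∎

          Σw≡0 : sumTo K M w ≡ 0#
          Σw≡0 = begin
            sumTo K M w                                       ≡⟨ sum-*ʳ M (φ (c L)) _ ⟩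
            sumTo K M (λ k → pf k * g (c k) (c 0)) * φ (c L)  ≡⟨ cong (_* φ (c L)) (weighted-first c y q sep) ⟩
            - pfSum (λ i → c (suc i)) y q * φ (c L)           ≡⟨ cong (λ z → - z * φ (c L)) first≡0 ⟩
            - 0# * φ (c L)                                    ≡⟨ cong (_* φ (c L)) -0#≡0# ⟩
            0# * φ (c L)                                      ≡⟨ zeroˡ _ ⟩
            0#                                                ∎

        pfSum-vanishes : ∀ p c y → Separated g c → pfSum c y p ≡ 0#
        pfSum-vanishes zero c y sep = begin
          0# + 1# * (1# * g (c 1) (c 0)) ⁻¹ + 1# * (1# * g (c 0) (c 1)) ⁻¹
            ≡⟨ cong₂ (λ s t → 0# + s + t) (trans (*-identityˡ _) (cong _⁻¹ (*-identityˡ _)))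
                                           (trans (*-identityˡ _) (cong _⁻¹ (*-identityˡ _))) ⟩
          0# + (g (c 1) (c 0)) ⁻¹ + (g (c 0) (c 1)) ⁻¹
            ≡⟨ cong (_+ (g (c 0) (c 1)) ⁻¹) (+-identityˡ _) ⟩
          (g (c 1) (c 0)) ⁻¹ + (g (c 0) (c 1)) ⁻¹
            ≡⟨ inverse-opposite _ _ (sep 1 0 (λ ())) (sep 0 1 (λ ()))
                 (trans (cong (_+ g (c 1) (c 0)) (antisym (c 0) (c 1))) (-‿inverseˡ _)) ⟩
          0# ∎
        pfSum-vanishes (suc q) c y sep =
          pfSum-step c y q sep (pfSum-vanishes q c y sep)
                               (pfSum-vanishes q (λ i → c (suc i)) y (separated-drop g c 1 sep))

module TriangularInversion (K : CharZeroField) where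
  open FieldLemmas K
  open FiniteSums K
  open ≡-Reasoning

  triangular-inversion :
    (T C : ℕ → ℕ → Carrier) (G Φ : ℕ → Carrier)
    → (∀ j k → k < j → T j k ≡ 0#)
    → (∀ n → T n n * C n n ≡ 1#)
    → (∀ j n → j < n → sumTo K (suc n) (λ k → T j k * C n k) ≡ 0#)
    → (∀ k → Φ k ≡ sumTo K (suc k) (λ j → G j * T j k))
    → ∀ n → G n ≡ sumTo K (suc n) (λ k → Φ k * C n k)
  triangular-inversion T C G Φ lower diagonal orthogonal expansion n = sym (begin
    sumTo K (suc n) (λ k → Φ k * C n k)
      ≡⟨ sum-cong (suc n) (λ k k≤n → cong (_* C n k) (trans (expansion k) (extend k k≤n))) ⟩
    sumTo K (suc n) (λ k → sumTo K (suc n) (λ j → G j * T j k) * C n k)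
      ≡⟨ sum-cong (suc n) (λ k _ → trans (sym (sum-*ʳ (suc n) (C n k) _))
                                         (sum-cong (suc n) (λ j _ → *-assoc _ _ _))) ⟩
    sumTo K (suc n) (λ k → sumTo K (suc n) (λ j → G j * (T j k * C n k)))
      ≡⟨ sum-swap (suc n) (suc n) _ ⟩
    sumTo K (suc n) (λ j → sumTo K (suc n) (λ k → G j * (T j k * C n k)))
      ≡⟨ sum-cong (suc n) (λ j _ → sum-*ˡ (suc n) (G j) _) ⟩
    sumTo K (suc n) (λ j → G j * sumTo K (suc n) (λ k → T j k * C n k))
      ≡⟨ cong₂ _+_ (sum-zero n (λ j j<n → trans (cong (G j *_) (orthogonal j n j<n)) (zeroʳ _)))
                   (trans (cong (G n *_) normalised) (*-identityʳ _)) ⟩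
    0# + G n  ≡⟨ +-identityˡ _ ⟩
    G n       ∎)
    where
    -- Terms with j > k vanish, so the sum over j ≤ k extends to j ≤ n.
    extend : ∀ k → k < suc n → sumTo K (suc k) (λ j → G j * T j k) ≡ sumTo K (suc n) (λ j → G j * T j k)
    extend k k≤n = begin
      sumTo K (suc k) (λ j → G j * T j k)
        ≡⟨ sym (sum-tail-zero (n ∸ k) (suc k) (λ j k<j → trans (cong (G j *_) (lower j k k<j)) (zeroʳ _))) ⟩
      sumTo K ((n ∸ k) +ℕ suc k) (λ j → G j * T j k)
        ≡⟨ cong (λ t → sumTo K t (λ j → G j * T j k))
                (trans (ℕₚ.+-suc (n ∸ k) k) (cong suc (ℕₚ.m∸n+n≡m {n} {k} (ℕₚ.≤-pred k≤n)))) ⟩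
      sumTo K (suc n) (λ j → G j * T j k) ∎

    normalised : sumTo K (suc n) (λ k → T n k * C n k) ≡ 1#
    normalised =
      trans (cong (_+ T n n * C n n) (sum-zero n (λ k k<n → trans (cong (_* C n k) (lower n k k<n)) (zeroˡ _))))
            (trans (+-identityˡ _) (diagonal n))

module Expansion (K : CharZeroField) where
  open FieldLemmas K
  open FiniteSums K
  open PartialFractions K
  open ≡-Reasoning

  -- The convention ∏_{i=1}^{-1} = 1/f(x_0,·) makes f(x_n,·) · ∏_{i=1}^{n-1}
  -- equal to ∏_{i=1}^{n} uniformly in n.
  numProd-step : ∀ (f : Carrier → Carrier → Carrier) x b k → f (x 0) (b k) ≢ 0# →
                 ∀ n → f (x n) (b k) * numProd K f x b n k ≡ prodTo K n (λ i → f (x (suc i)) (b k))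
  numProd-step f x b k f₀≢0 zero    = inverse _ f₀≢0
  numProd-step f x b k f₀≢0 (suc m) = *-comm _ _

  module Kernel (f g : Carrier → Carrier → Carrier)
           (antisym : ∀ u v → g u v ≡ - g v u)
           (three-term : ∀ a b c y → g a b * f y c + g b c * f y a + g c a * f y b ≡ 0#)
           (x b : ℕ → Carrier)
           (f≢0 : ∀ i k → f (x i) (b k) ≢ 0#)
           (separated : Separated g b) where

    T : ℕ → ℕ → Carrier
    T j k = f (x j) (b j) * prodTo K j (λ i → g (b i) (b k)) * (prodTo K j (λ i → f (x (suc i)) (b k))) ⁻¹

    C : ℕ → ℕ → Carrier
    C n k = numProd K f x b n k * (prodToExcept K (suc n) k (λ i → g (b i) (b k))) ⁻¹

    expTerm-factor : ∀ G j k → expTerm K f g x b G j (b k) ≡ G j * T j k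
    expTerm-factor G j k = trans (*-assoc _ _ _) (trans (*-assoc _ _ _) (cong (G j *_) (sym (*-assoc _ _ _))))

    -- T j k contains the factor g(b_k, b_k) = 0 once k < j.
    T-lower : ∀ j k → k < j → T j k ≡ 0#
    T-lower j k k<j = begin
      f (x j) (b j) * prodTo K j H * Q ⁻¹  ≡⟨ cong (λ z → f (x j) (b j) * z * Q ⁻¹)
                                                 (prod-zero j H k k<j (g-diagonal antisym (b k))) ⟩
      f (x j) (b j) * 0# * Q ⁻¹            ≡⟨ cong (_* Q ⁻¹) (zeroʳ _) ⟩
      0# * Q ⁻¹                            ≡⟨ zeroˡ _ ⟩
      0#                                   ∎
      where
      H = λ i → g (b i) (b k)
      Q = prodTo K j (λ i → f (x (suc i)) (b k))

    -- Diagonal entries: f(x_n,b_n) · numProd n n cancels ∏_{i<n} f(x_{i+1},b_n)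
    -- and ∏_{i<n} g(b_i,b_n) cancels against itself.
    T-diagonal : ∀ n → T n n * C n n ≡ 1#
    T-diagonal n = begin
      f (x n) (b n) * P * Q ⁻¹ * (numProd K f x b n n * (prodToExcept K (suc n) n H) ⁻¹)
        ≡⟨ cong (λ z → f (x n) (b n) * P * Q ⁻¹ * (numProd K f x b n n * z ⁻¹)) (except-last n H) ⟩
      f (x n) (b n) * P * Q ⁻¹ * (numProd K f x b n n * P ⁻¹)
        ≡⟨ ×-Solver.solve 5 (λ a p q' r p' → ((a ⊕ p) ⊕ q') ⊕ (r ⊕ p') ⊜ ((a ⊕ r) ⊕ q') ⊕ (p ⊕ p'))
                           refl (f (x n) (b n)) P (Q ⁻¹) (numProd K f x b n n) (P ⁻¹) ⟩
      f (x n) (b n) * numProd K f x b n n * Q ⁻¹ * (P * P ⁻¹)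
        ≡⟨ cong₂ (λ s t → s * Q ⁻¹ * t) (numProd-step f x b n (f≢0 0 n) n) (inverse P P≢0) ⟩
      Q * Q ⁻¹ * 1#  ≡⟨ trans (*-identityʳ _) (inverse Q Q≢0) ⟩
      1#             ∎
      where
      H = λ i → g (b i) (b n)
      P = prodTo K n H
      Q = prodTo K n (λ i → f (x (suc i)) (b n))
      P≢0 = prod-nonzero n H (λ i i<n → separated i n (ℕₚ.<⇒≢ i<n))
      Q≢0 = prod-nonzero n _ (λ i _ → f≢0 (suc i) n)

    shifted-length : ∀ j d → j +ℕ suc (suc d) ≡ suc (suc (j +ℕ d))
    shifted-length j d = trans (ℕₚ.+-suc j (suc d)) (cong suc (ℕₚ.+-suc j d))

    kernel-as-pfCoeff : ∀ j d k →
      T j (j +ℕ k) * C (suc (j +ℕ d)) (j +ℕ k)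
        ≡ f (x j) (b j) * pfCoeff f g (λ i → b (j +ℕ i)) (λ l → x (suc (j +ℕ l))) d (suc (suc d)) k
    kernel-as-pfCoeff j d k = begin
      f (x j) (b j) * P * Q ⁻¹ * (prodTo K (j +ℕ d) (λ i → f (x (suc i)) (b (j +ℕ k))) * (prodToExcept K (suc (suc (j +ℕ d))) (j +ℕ k) H) ⁻¹)
        ≡⟨ cong₂ (λ s t → f (x j) (b j) * P * Q ⁻¹ * (s * t ⁻¹)) (prod-split j d _)
                 (trans (cong (λ t → prodToExcept K t (j +ℕ k) H) (sym (shifted-length j d)))
                        (except-split j (suc (suc d)) k H)) ⟩
      f (x j) (b j) * P * Q ⁻¹ * (Q * R * (P * E) ⁻¹)
        ≡⟨ cancel-factors (f (x j) (b j)) P Q R E P≢0 Q≢0 E≢0 ⟩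
      f (x j) (b j) * (R * E ⁻¹) ∎
      where
      H = λ i → g (b i) (b (j +ℕ k))
      P = prodTo K j H
      Q = prodTo K j (λ i → f (x (suc i)) (b (j +ℕ k)))
      R = prodTo K d (λ l → f (x (suc (j +ℕ l))) (b (j +ℕ k)))
      E = prodToExcept K (suc (suc d)) k (λ i → H (j +ℕ i))
      P≢0 = prod-nonzero j H (λ i i<j → separated i (j +ℕ k) (ℕₚ.<⇒≢ (ℕₚ.<-≤-trans i<j (ℕₚ.m≤m+n j k))))
      Q≢0 = prod-nonzero j _ (λ i _ → f≢0 (suc i) (j +ℕ k))
      E≢0 = except-nonzero (suc (suc d)) k _ (λ i _ → separated-drop g b j separated i k)

    -- Off-diagonal entries vanish by the partial-fraction identity.
    T-orthogonal : ∀ j n → j < n → sumTo K (suc n) (λ k → T j k * C n k) ≡ 0#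
    T-orthogonal j n j<n =
      subst (λ t → sumTo K (suc t) (λ k → T j k * C t k) ≡ 0#) (ℕₚ.m+[n∸m]≡n j<n) (offset (n ∸ suc j))
      where
      offset : ∀ d → sumTo K (suc (suc (j +ℕ d))) (λ k → T j k * C (suc (j +ℕ d)) k) ≡ 0#
      offset d = begin
        sumTo K (suc (suc (j +ℕ d))) h
          ≡⟨ cong (λ t → sumTo K t h) (sym (shifted-length j d)) ⟩
        sumTo K (j +ℕ suc (suc d)) h
          ≡⟨ sum-head-zero j (suc (suc d)) (λ k k<j → trans (cong (_* C (suc (j +ℕ d)) k) (T-lower j k k<j)) (zeroˡ _)) ⟩
        sumTo K (suc (suc d)) (λ k → h (j +ℕ k))
          ≡⟨ sum-cong (suc (suc d)) (λ k _ → kernel-as-pfCoeff j d k) ⟩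
        sumTo K (suc (suc d)) (λ k → f (x j) (b j) * pfCoeff f g c y d (suc (suc d)) k)
          ≡⟨ sum-*ˡ (suc (suc d)) _ _ ⟩
        f (x j) (b j) * pfSum f g c y d
          ≡⟨ cong (f (x j) (b j) *_) (pfSum-vanishes f g antisym three-term d c y
                                        (separated-drop g b j separated)) ⟩
        f (x j) (b j) * 0#  ≡⟨ zeroʳ _ ⟩
        0#                  ∎
        where
        h = λ k → T j k * C (suc (j +ℕ d)) k
        c = λ i → b (j +ℕ i)
        y = λ l → x (suc (j +ℕ l))

    expansion-at-node : (F : Carrier → Carrier) (G : ℕ → Carrier) →
      (∀ m → ∃ λ N₀ → ∀ N → N₀ ≤ N → F (b m) ≡ sumTo K (suc N) (λ n → expTerm K f g x b G n (b m)))
      → ∀ k → F (b k) ≡ sumTo K (suc k) (λ j → G j * T j k)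
    expansion-at-node F G converges k with converges k
    ... | N₀ , eventually = begin
      F (b k)                                          ≡⟨ eventually (N₀ +ℕ k) (ℕₚ.m≤m+n N₀ k) ⟩
      sumTo K (suc (N₀ +ℕ k)) (λ j → E j)               ≡⟨ cong (λ t → sumTo K t E) (sym (ℕₚ.+-suc N₀ k)) ⟩
      sumTo K (N₀ +ℕ suc k) E                           ≡⟨ sum-tail-zero N₀ (suc k) (λ j k<j →
                                                            trans (expTerm-factor G j k)
                                                                  (trans (cong (G j *_) (T-lower j k k<j)) (zeroʳ _))) ⟩
      sumTo K (suc k) E                                ≡⟨ sum-cong (suc k) (λ j _ → expTerm-factor G j k) ⟩
      sumTo K (suc k) (λ j → G j * T j k)              ∎
      where
      E = λ j → expTerm K f g x b G j (b k)

-- The theorem: triangular inversion applied to the kernel T, C of the expansion.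
lemma2p2 : (K : CharZeroField) → let open CharZeroField K in
    (f g : Carrier → Carrier → Carrier)
    → (∀ u v → g u v ≡ - g v u)
    → (∀ a b c y → g a b * f y c + g b c * f y a + g c a * f y b ≡ 0#)
    → (x b : ℕ → Carrier)
    → (∀ i k → i ≢ k → b i ≢ b k)
    → (∀ i k → f (x i) (b k) ≢ 0#)
    → (∀ i k → i ≢ k → g (b i) (b k) ≢ 0#)
    → (F : Carrier → Carrier) (G : ℕ → Carrier)
    → (∀ m → ∃ λ N₀ → ∀ N → N₀ ≤ N →
         F (b m) ≡ sumTo K (suc N) (λ n → expTerm K f g x b G n (b m)))
    → ∀ n → G n ≡ inversionFormula K f g x b F n
lemma2p2 K f g antisym three-term x b _ f≢0 separated F G converges n =
  trans (triangular-inversion T C G (λ k → F (b k)) T-lower T-diagonal T-orthogonal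
                              (expansion-at-node F G converges) n)
        (sum-cong (suc n) (λ k _ → sym (*-assoc _ _ _)))
  where
  open FieldLemmas K using (*-assoc)
  open FiniteSums K using (sum-cong)
  open TriangularInversion K using (triangular-inversion)
  open Expansion.Kernel K f g antisym three-term x b f≢0 separated
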